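{- The system $\mathsf{DG}+(\mathsf{E}_2)^{\mathrm{st}}$ is inconsistent, where $(\mathsf E_2)^{\mathrm{st}}$ (standard extensionality for type 2) is $(\forall^{\mathrm{st}}Y^{2})(\forall^{\mathrm{st}}f^{1},g^{1})\big[(\forall^{\mathrm{st}}n^0)(f(n)=g(n))\rightarrow Y(f)=_0Y(g)\big]$.
   Context: Finite types: $0$ is a type and if $\rho,\sigma$ are types so is $\rho\to\sigma$; type $1=0\to0$, $2=1\to0$. $\mathsf{E\text{ - }HA}^{\omega}$ is Heyting arithmetic in all finite types (intuitionistic logic, Gödel's $T$ constants) with extensionality. Equality $=_0$ is primitive; for $\tau=\tau_1\to\dots\to\tau_k\to0$, $x=_\tau y$ abbreviates $(\forall z_1\dots z_k)(xz_1\dots z_k=_0yz_1\dots z_k)$, and $\le_\tau$ likewise. Extensionality $(\mathsf E_{\rho\to\tau})$: $(\forall\varphi)(\forall x,y)(x=_\rho y\to\varphi(x)=_\tau\varphi(y))$, for all types. Strong majorizability (Howard–Bezem): $x\le^*_0 y$ iff $x\le_0 y$; $x\le^*_{\rho\to\sigma}y$ iff for all $u,v$ with $u\le^*_\rho v$: $xu\le^*_\sigma yv$ and $yu\le^*_\sigma yv$. Monotone: $x\le^*x$; $\tilde\forall,\tilde\exists$ range over monotone objects. The language of $\mathsf{DG}$ adds predicates $\mathrm{st}^\sigma$ ("is standard"); $\forall^{\mathrm{st}},\exists^{\mathrm{st}}$ are the relativised quantifiers, $\tilde\forall^{\mathrm{st}},\tilde\exists^{\mathrm{st}}$ combine both restrictions.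 Internal = not containing $\mathrm{st}$. $\mathsf{DG}$ is $\mathsf{E\text{ - }HA}^\omega$ in the extended language plus: (a) $x=_\sigma y\to(\mathrm{st}(x)\to\mathrm{st}(y))$; (b) $\mathrm{st}(y)\to(x\le^*_\sigma y\to\mathrm{st}(x))$; (c) $\mathrm{st}(t)$ for closed terms $t$; (d) $\mathrm{st}(z)\to(\mathrm{st}(x)\to\mathrm{st}(zx))$; external induction $\Phi(0)\wedge(\forall^{\mathrm{st}}n)(\Phi(n)\to\Phi(n+1))\to(\forall^{\mathrm{st}}n)\Phi(n)$ for any $\Phi$; and for arbitrary $\Phi,\Psi$ and internal $\phi,\psi$: $\mathsf{mAC}^\omega$: $(\tilde\forall^{\mathrm{st}}x)(\tilde\exists^{\mathrm{st}}y)\Phi(x,y)\to(\tilde\exists^{\mathrm{st}}f)(\tilde\forall^{\mathrm{st}}x)(\exists y\le^*f(x))\Phi(x,y)$; $\mathsf R^\omega$: $(\forall x)(\exists^{\mathrm{st}}y)\Phi(x,y)\to(\tilde\exists^{\mathrm{st}}z)(\forall x)(\exists y\le^*z)\Phi(x,y)$; $\mathsf I^\omega$: $(\tilde\forall^{\mathrm{st}}z)(\exists x)(\forall y\le^*z)\phi(x,y)\to(\exists x)(\forall^{\mathrm{st}}y)\phi(x,y)$; $\mathsf{IP}^\omega_{\tilde\forall^{\mathrm{st}}}$: $[(\tilde\forall^{\mathrm{st}}x)\phi(x)\to(\tilde\exists^{\mathrm{st}}y)\Psi(y)]\to(\tilde\exists^{\mathrm{st}}z)[(\tilde\forall^{\mathrm{st}}x)\phi(x)\to(\tilde\exists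 y\le^*z)\Psi(y)]$; $\mathsf M^\omega$: $[(\tilde\forall^{\mathrm{st}}x)\phi(x)\to\psi]\to(\tilde\exists^{\mathrm{st}}y)[(\forall x\le^*y)\phi(x)\to\psi]$; $\mathsf{MAJ}^\omega$: $(\forall^{\mathrm{st}}x)(\exists^{\mathrm{st}}y)(x\le^*y)$. -}

module Defs where

-- A deep embedding of the formal system DG (nonstandard Heyting arithmetic
-- in all finite types, combinatory formulation of Goedel's T) together with
-- an intuitionistic natural-deduction derivability relation.

open import Data.List using (List; []; _∷_; map)
open import Data.List.Membership.Propositional using (_∈_)

infixr 6 _⇒_
data Ty : Set where
  ι   : Ty                 -- the type 0 (natural numbers)
  _⇒_ : Ty → Ty → Ty

ty1 : Ty
ty1 = ι ⇒ ι

ty2 : Ty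
ty2 = ty1 ⇒ ι

Ctx : Set
Ctx = List Ty

infix 4 _∋_
data _∋_ : Ctx → Ty → Set where
  here  : ∀ {Γ σ} → (σ ∷ Γ) ∋ σ
  there : ∀ {Γ σ τ} → Γ ∋ σ → (τ ∷ Γ) ∋ σ

-- Terms of Goedel's T (combinatory form): 0, S, Π (K), Σ (S), R

infixl 9 _·_
data Tm (Γ : Ctx) : Ty → Set where
  var  : ∀ {σ} → Γ ∋ σ → Tm Γ σ
  zer  : Tm Γ ι
  suc  : Tm Γ (ι ⇒ ι)
  Πc   : ∀ ρ σ → Tm Γ (ρ ⇒ σ ⇒ ρ)
  Σc   : ∀ δ ρ τ → Tm Γ ((δ ⇒ ρ ⇒ τ) ⇒ (δ ⇒ ρ) ⇒ δ ⇒ τ)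
  Rc   : ∀ ρ → Tm Γ (ι ⇒ ρ ⇒ (ρ ⇒ ι ⇒ ρ) ⇒ ρ)
  _·_  : ∀ {σ τ} → Tm Γ (σ ⇒ τ) → Tm Γ σ → Tm Γ τ

infixr 3 _⊃_
infixr 4 _∨'_
infixr 5 _∧'_
infix 6 _≐_
data Fm (Γ : Ctx) : Set where
  _≐_  : Tm Γ ι → Tm Γ ι → Fm Γ
  st   : ∀ {σ} → Tm Γ σ → Fm Γ
  ⊥'   : Fm Γ
  _∧'_ : Fm Γ → Fm Γ → Fm Γ
  _∨'_ : Fm Γ → Fm Γ → Fm Γ
  _⊃_  : Fm Γ → Fm Γ → Fm Γ
  ∀'   : ∀ σ → Fm (σ ∷ Γ) → Fm Γ
  ∃'   : ∀ σ → Fm (σ ∷ Γ) → Fm Γ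

data Internal : ∀ {Γ} → Fm Γ → Set where
  i≐ : ∀ {Γ} {s t : Tm Γ ι} → Internal (s ≐ t)
  i⊥ : ∀ {Γ} → Internal {Γ} ⊥'
  i∧ : ∀ {Γ} {φ ψ : Fm Γ} → Internal φ → Internal ψ → Internal (φ ∧' ψ)
  i∨ : ∀ {Γ} {φ ψ : Fm Γ} → Internal φ → Internal ψ → Internal (φ ∨' ψ)
  i⊃ : ∀ {Γ} {φ ψ : Fm Γ} → Internal φ → Internal ψ → Internal (φ ⊃ ψ)
  i∀ : ∀ {Γ σ} {φ : Fm (σ ∷ Γ)} → Internal φ → Internal (∀' σ φ)
  i∃ : ∀ {Γ σ} {φ : Fm (σ ∷ Γ)} → Internal φ → Internal (∃' σ φ)

Ren : Ctx → Ctx → Set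
Ren Γ Δ = ∀ {σ} → Γ ∋ σ → Δ ∋ σ

extR : ∀ {Γ Δ τ} → Ren Γ Δ → Ren (τ ∷ Γ) (τ ∷ Δ)
extR r here      = here
extR r (there x) = there (r x)

renT : ∀ {Γ Δ σ} → Ren Γ Δ → Tm Γ σ → Tm Δ σ
renT r (var x)      = var (r x)
renT r zer          = zer
renT r suc          = suc
renT r (Πc ρ σ)     = Πc ρ σ
renT r (Σc δ ρ τ)   = Σc δ ρ τ
renT r (Rc ρ)       = Rc ρ
renT r (s · t)      = renT r s · renT r t

renF : ∀ {Γ Δ} → Ren Γ Δ → Fm Γ → Fm Δ
renF r (s ≐ t)   = renT r s ≐ renT r t
renF r (st t)    = st (renT r t)
renF r ⊥'        = ⊥'
renF r (φ ∧' ψ)  = renF r φ ∧' renF r ψ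
renF r (φ ∨' ψ)  = renF r φ ∨' renF r ψ
renF r (φ ⊃ ψ)   = renF r φ ⊃ renF r ψ
renF r (∀' σ φ)  = ∀' σ (renF (extR r) φ)
renF r (∃' σ φ)  = ∃' σ (renF (extR r) φ)

Sub : Ctx → Ctx → Set
Sub Γ Δ = ∀ {σ} → Γ ∋ σ → Tm Δ σ

extS : ∀ {Γ Δ τ} → Sub Γ Δ → Sub (τ ∷ Γ) (τ ∷ Δ)
extS s here      = var here
extS s (there x) = renT there (s x)

subT : ∀ {Γ Δ σ} → Sub Γ Δ → Tm Γ σ → Tm Δ σ
subT s (var x)      = s x
subT s zer          = zer
subT s suc          = suc
subT s (Πc ρ σ)     = Πc ρ σ
subT s (Σc δ ρ τ)   = Σc δ ρ τ
subT s (Rc ρ)       = Rc ρ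
subT s (a · b)      = subT s a · subT s b

subF : ∀ {Γ Δ} → Sub Γ Δ → Fm Γ → Fm Δ
subF s (a ≐ b)   = subT s a ≐ subT s b
subF s (st t)    = st (subT s t)
subF s ⊥'        = ⊥'
subF s (φ ∧' ψ)  = subF s φ ∧' subF s ψ
subF s (φ ∨' ψ)  = subF s φ ∨' subF s ψ
subF s (φ ⊃ ψ)   = subF s φ ⊃ subF s ψ
subF s (∀' σ φ)  = ∀' σ (subF (extS s) φ)
subF s (∃' σ φ)  = ∃' σ (subF (extS s) φ)

wkT : ∀ {Γ σ τ} → Tm Γ σ → Tm (τ ∷ Γ) σ
wkT = renT there

wk2T : ∀ {Γ σ τ₁ τ₂} → Tm Γ σ → Tm (τ₁ ∷ τ₂ ∷ Γ) σ
wk2T = renT (λ x → there (there x))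

wkF : ∀ {Γ τ} → Fm Γ → Fm (τ ∷ Γ)
wkF = renF there

closedR : ∀ {Γ} → Ren [] Γ
closedR ()

single : ∀ {Γ σ} → Tm Γ σ → Sub (σ ∷ Γ) Γ
single t here      = t
single t (there x) = var x

infix 8 _[_]
_[_] : ∀ {Γ σ} → Fm (σ ∷ Γ) → Tm Γ σ → Fm Γ
φ [ t ] = subF (single t) φ

sucSub : ∀ {Γ} → Sub (ι ∷ Γ) (ι ∷ Γ)
sucSub here      = suc · var here
sucSub (there x) = var (there x)

v0 : ∀ {Γ σ} → Tm (σ ∷ Γ) σ
v0 = var here
v1 : ∀ {Γ σ τ} → Tm (τ ∷ σ ∷ Γ) σ
v1 = var (there here)
v2 : ∀ {Γ σ τ₁ τ₂} → Tm (τ₁ ∷ τ₂ ∷ σ ∷ Γ) σ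
v2 = var (there (there here))

-- addition as a closed term: s + t := R t s (λx.λy. S x),
-- with λx.λy.Sx = Σ (Π Π) S
stepT : ∀ {Γ} → Tm Γ (ι ⇒ ι ⇒ ι)
stepT = Σc ι ι (ι ⇒ ι) · (Πc (ι ⇒ ι ⇒ ι) ι · Πc ι ι) · suc

plusT : ∀ {Γ} → Tm Γ ι → Tm Γ ι → Tm Γ ι
plusT s t = Rc ι · t · s · stepT

leq : ∀ {Γ} → Tm Γ ι → Tm Γ ι → Fm Γ
leq s t = ∃' ι (plusT (wkT s) v0 ≐ wkT t)

eqT : ∀ {Γ} σ → Tm Γ σ → Tm Γ σ → Fm Γ
eqT ι s t       = s ≐ t
eqT (σ ⇒ τ) s t = ∀' σ (eqT τ (wkT s · v0) (wkT t · v0))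

-- strong majorizability x ≤*_σ y (Howard–Bezem)
maj : ∀ {Γ} σ → Tm Γ σ → Tm Γ σ → Fm Γ
maj ι s t       = leq s t
maj (σ ⇒ τ) s t =
  ∀' σ (∀' σ (maj σ v1 v0 ⊃
    (maj τ (wk2T s · v1) (wk2T t · v0) ∧' maj τ (wk2T t · v1) (wk2T t · v0))))

mono : ∀ {Γ} σ → Tm Γ σ → Fm Γ
mono σ t = maj σ t t

∀st ∃st ∀~st ∃~st : ∀ {Γ} σ → Fm (σ ∷ Γ) → Fm Γ
∀st σ φ  = ∀' σ (st v0 ⊃ φ)
∃st σ φ  = ∃' σ (st v0 ∧' φ)
∀~st σ φ = ∀' σ ((st v0 ∧' mono σ v0) ⊃ φ)
∃~st σ φ = ∃' σ ((st v0 ∧' mono σ v0) ∧' φ)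

∀≤ ∃≤ ∃~≤ : ∀ {Γ} σ → Tm Γ σ → Fm (σ ∷ Γ) → Fm Γ
∀≤ σ b φ  = ∀' σ (maj σ v0 (wkT b) ⊃ φ)
∃≤ σ b φ  = ∃' σ (maj σ v0 (wkT b) ∧' φ)
∃~≤ σ b φ = ∃' σ ((mono σ v0 ∧' maj σ v0 (wkT b)) ∧' φ)

skip2 : ∀ {Γ a b c} → Ren (a ∷ b ∷ Γ) (a ∷ b ∷ c ∷ Γ)
skip2 = extR (extR there)

-- Axioms of DG (schemas; free variables act as parameters)

data DGAx : ∀ {Γ} → Fm Γ → Set where
  eq-refl  : ∀ {Γ} (t : Tm Γ ι) → DGAx (t ≐ t)
  eq-sub   : ∀ {Γ} (φ : Fm (ι ∷ Γ)) (s t : Tm Γ ι) →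
             DGAx (s ≐ t ⊃ φ [ s ] ⊃ φ [ t ])
  suc-ne   : ∀ {Γ} (t : Tm Γ ι) → DGAx ((suc · t ≐ zer) ⊃ ⊥')
  suc-inj  : ∀ {Γ} (s t : Tm Γ ι) → DGAx (suc · s ≐ suc · t ⊃ s ≐ t)
  ax-Π     : ∀ {Γ ρ σ} (x : Tm Γ ρ) (y : Tm Γ σ) →
             DGAx (eqT ρ (Πc ρ σ · x · y) x)
  ax-Σ     : ∀ {Γ δ ρ τ} (x : Tm Γ (δ ⇒ ρ ⇒ τ)) (y : Tm Γ (δ ⇒ ρ)) (z : Tm Γ δ) →
             DGAx (eqT τ (Σc δ ρ τ · x · y · z) (x · z · (y · z)))
  ax-R0    : ∀ {Γ ρ} (y : Tm Γ ρ) (z : Tm Γ (ρ ⇒ ι ⇒ ρ)) →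
             DGAx (eqT ρ (Rc ρ · zer · y · z) y)
  ax-RS    : ∀ {Γ ρ} (n : Tm Γ ι) (y : Tm Γ ρ) (z : Tm Γ (ρ ⇒ ι ⇒ ρ)) →
             DGAx (eqT ρ (Rc ρ · (suc · n) · y · z) (z · (Rc ρ · n · y · z) · n))
  ind      : ∀ {Γ} (φ : Fm (ι ∷ Γ)) → Internal φ →
             DGAx ((φ [ zer ] ∧' ∀' ι (φ ⊃ subF sucSub φ)) ⊃ ∀' ι φ)
  ext      : ∀ {Γ ρ τ} (f : Tm Γ (ρ ⇒ τ)) (x y : Tm Γ ρ) →
             DGAx (eqT ρ x y ⊃ eqT τ (f · x) (f · y))
  st-eq    : ∀ {Γ σ} (x y : Tm Γ σ) → DGAx (eqT σ x y ⊃ st x ⊃ st y)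
  st-maj   : ∀ {Γ σ} (x y : Tm Γ σ) → DGAx (st y ⊃ maj σ x y ⊃ st x)
  st-closed : ∀ {Γ σ} (t : Tm [] σ) → DGAx {Γ} (st (renT closedR t))
  st-app   : ∀ {Γ σ τ} (z : Tm Γ (σ ⇒ τ)) (x : Tm Γ σ) →
             DGAx (st z ⊃ st x ⊃ st (z · x))
  ext-ind  : ∀ {Γ} (Φ : Fm (ι ∷ Γ)) →
             DGAx ((Φ [ zer ] ∧' ∀st ι (Φ ⊃ subF sucSub Φ)) ⊃ ∀st ι Φ)
  mAC      : ∀ {Γ σ τ} (Φ : Fm (τ ∷ σ ∷ Γ)) →
             DGAx (∀~st σ (∃~st τ Φ) ⊃
                   ∃~st (σ ⇒ τ) (∀~st σ (∃≤ τ (v1 · v0) (renF skip2 Φ))))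
  Rω       : ∀ {Γ σ τ} (Φ : Fm (τ ∷ σ ∷ Γ)) →
             DGAx (∀' σ (∃st τ Φ) ⊃ ∃~st τ (∀' σ (∃≤ τ v1 (renF skip2 Φ))))
  Iω       : ∀ {Γ σ τ} (φ : Fm (τ ∷ σ ∷ Γ)) → Internal φ →
             DGAx (∀~st τ (∃' σ (∀≤ τ v1 (renF skip2 φ))) ⊃ ∃' σ (∀st τ φ))
  IPω      : ∀ {Γ σ τ} (φ : Fm (σ ∷ Γ)) → Internal φ → (Ψ : Fm (τ ∷ Γ)) →
             DGAx ((∀~st σ φ ⊃ ∃~st τ Ψ) ⊃
                   ∃~st τ (∀~st σ (renF (extR there) φ) ⊃ ∃~≤ τ v0 (renF (extR there) Ψ)))
  Mω       : ∀ {Γ σ} (φ : Fm (σ ∷ Γ)) → Internal φ → (ψ : Fm Γ) → Internal ψ →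
             DGAx ((∀~st σ φ ⊃ ψ) ⊃ ∃~st σ (∀≤ σ v0 (renF (extR there) φ) ⊃ wkF ψ))
  MAJω     : ∀ {Γ σ} → DGAx {Γ} (∀st σ (∃st σ (maj σ v1 v0)))

data Der (Ax : ∀ {Γ} → Fm Γ → Set) : ∀ {Γ} → List (Fm Γ) → Fm Γ → Set where
  hyp  : ∀ {Γ Δ} {φ : Fm Γ} → φ ∈ Δ → Der Ax Δ φ
  axm  : ∀ {Γ Δ} {φ : Fm Γ} → Ax φ → Der Ax Δ φ
  ∧I   : ∀ {Γ Δ} {φ ψ : Fm Γ} → Der Ax Δ φ → Der Ax Δ ψ → Der Ax Δ (φ ∧' ψ)
  ∧E₁  : ∀ {Γ Δ} {φ ψ : Fm Γ} → Der Ax Δ (φ ∧' ψ) → Der Ax Δ φ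
  ∧E₂  : ∀ {Γ Δ} {φ ψ : Fm Γ} → Der Ax Δ (φ ∧' ψ) → Der Ax Δ ψ
  ∨I₁  : ∀ {Γ Δ} {φ ψ : Fm Γ} → Der Ax Δ φ → Der Ax Δ (φ ∨' ψ)
  ∨I₂  : ∀ {Γ Δ} {φ ψ : Fm Γ} → Der Ax Δ ψ → Der Ax Δ (φ ∨' ψ)
  ∨E   : ∀ {Γ Δ} {φ ψ χ : Fm Γ} → Der Ax Δ (φ ∨' ψ) →
         Der Ax (φ ∷ Δ) χ → Der Ax (ψ ∷ Δ) χ → Der Ax Δ χ
  ⊃I   : ∀ {Γ Δ} {φ ψ : Fm Γ} → Der Ax (φ ∷ Δ) ψ → Der Ax Δ (φ ⊃ ψ)
  ⊃E   : ∀ {Γ Δ} {φ ψ : Fm Γ} → Der Ax Δ (φ ⊃ ψ) → Der Ax Δ φ → Der Ax Δ ψ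
  ⊥E   : ∀ {Γ Δ} {φ : Fm Γ} → Der Ax Δ ⊥' → Der Ax Δ φ
  ∀I   : ∀ {Γ Δ σ} {φ : Fm (σ ∷ Γ)} → Der Ax (map wkF Δ) φ → Der Ax Δ (∀' σ φ)
  ∀E   : ∀ {Γ Δ σ} {φ : Fm (σ ∷ Γ)} → Der Ax Δ (∀' σ φ) → (t : Tm Γ σ) → Der Ax Δ (φ [ t ])
  ∃I   : ∀ {Γ Δ σ} {φ : Fm (σ ∷ Γ)} (t : Tm Γ σ) → Der Ax Δ (φ [ t ]) → Der Ax Δ (∃' σ φ)
  ∃E   : ∀ {Γ Δ σ} {φ : Fm (σ ∷ Γ)} {χ : Fm Γ} → Der Ax Δ (∃' σ φ) →
         Der Ax (φ ∷ map wkF Δ) (wkF χ) → Der Ax Δ χ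

E2st : Fm []
E2st = ∀st ty2 (∀st ty1 (∀st ty1
         (∀st ι (v2 · v0 ≐ v1 · v0) ⊃ (v2 · v1 ≐ v2 · v0))))

data DG+E2st : ∀ {Γ} → Fm Γ → Set where
  dg : ∀ {Γ} {φ : Fm Γ} → DGAx φ → DG+E2st φ
  e2 : ∀ {Γ} → DG+E2st {Γ} (renF closedR E2st)

Inconsistent : (∀ {Γ} → Fm Γ → Set) → Set
Inconsistent Ax = Der Ax {[]} [] ⊥'

module Submission where

-- By I^ω there is an N with n < N for every standard n. The functions
-- g(n) = sg(N ∸ n) and Y(h) = sg(h N) are pointwise bounded by 1, so they are
-- strongly majorized by closed constant functions and are standard by axiom (b).
-- Since g agrees with the constant 1 on all standard arguments, (E₂)^st yields
-- Y(1) = Y(g), that is 1 = sg 1 = sg(g N) = sg(sg 0) = 0.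

open import Defs
open import Data.List using (List; []; _∷_)
open import Data.List.Relation.Unary.Any using () renaming (here to hd; there to tl)
open import Relation.Binary.PropositionalEquality
  using (_≡_; refl; sym; trans; cong₂; subst)

infix 2 _⊢_
_⊢_ : ∀ {Γ} → List (Fm Γ) → Fm Γ → Set
_⊢_ = Der DG+E2st

ax : ∀ {Γ Δ} {φ : Fm Γ} → DGAx φ → Δ ⊢ φ
ax a = axm (dg a)

renT-subT : ∀ {Γ Δ Θ σ} (s : Sub Δ Θ) (r : Ren Γ Δ) (t : Tm Γ σ) →
            subT s (renT r t) ≡ subT (λ x → s (r x)) t
renT-subT s r (var x)    = refl
renT-subT s r zer        = refl
renT-subT s r suc        = refl
renT-subT s r (Πc ρ σ)   = refl
renT-subT s r (Σc δ ρ τ) = refl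
renT-subT s r (Rc ρ)     = refl
renT-subT s r (a · b)    = cong₂ _·_ (renT-subT s r a) (renT-subT s r b)

subT-id : ∀ {Γ σ} (s : Sub Γ Γ) → (∀ {τ} (x : Γ ∋ τ) → s x ≡ var x) →
          (t : Tm Γ σ) → subT s t ≡ t
subT-id s s≗var (var x)    = s≗var x
subT-id s s≗var zer        = refl
subT-id s s≗var suc        = refl
subT-id s s≗var (Πc ρ σ)   = refl
subT-id s s≗var (Σc δ ρ τ) = refl
subT-id s s≗var (Rc ρ)     = refl
subT-id s s≗var (a · b)    = cong₂ _·_ (subT-id s s≗var a) (subT-id s s≗var b)

single-wkT : ∀ {Γ σ τ} (u : Tm Γ τ) (t : Tm Γ σ) → subT (single u) (wkT t) ≡ t
single-wkT u t = trans (renT-subT (single u) there t) (subT-id _ (λ x → refl) t)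

≐-sym : ∀ {Γ Δ} {a b : Tm Γ ι} → Δ ⊢ a ≐ b → Δ ⊢ b ≐ a
≐-sym {Δ = Δ} {a} {b} a≐b =
  subst (λ x → Δ ⊢ b ≐ x) (single-wkT b a)
    (⊃E (⊃E (ax (eq-sub (v0 ≐ wkT a) a b)) a≐b)
        (subst (λ x → Δ ⊢ a ≐ x) (sym (single-wkT a a)) (ax (eq-refl a))))

infixr 2 _⟫_
_⟫_ : ∀ {Γ Δ} {a b c : Tm Γ ι} → Δ ⊢ a ≐ b → Δ ⊢ b ≐ c → Δ ⊢ a ≐ c
_⟫_ {Δ = Δ} {a} {b} {c} a≐b b≐c =
  subst (λ x → Δ ⊢ x ≐ c) (single-wkT c a)
    (⊃E (⊃E (ax (eq-sub (wkT a ≐ v0) b c)) b≐c)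
        (subst (λ x → Δ ⊢ x ≐ b) (sym (single-wkT b a)) a≐b))

≐-cong : ∀ {Γ Δ} (C : Tm (ι ∷ Γ) ι) {s t : Tm Γ ι} → Δ ⊢ s ≐ t →
         Δ ⊢ subT (single s) C ≐ subT (single t) C
≐-cong {Δ = Δ} C {s} {t} s≐t =
  subst (λ x → Δ ⊢ x ≐ C[ t ]) (single-wkT t C[ s ])
    (⊃E (⊃E (ax (eq-sub (wkT C[ s ] ≐ C) s t)) s≐t)
        (subst (λ x → Δ ⊢ x ≐ C[ s ]) (sym (single-wkT s C[ s ])) (ax (eq-refl _))))
  where
  C[_] : Tm _ ι → Tm _ ι
  C[ u ] = subT (single u) C

v3 : ∀ {Γ σ τ₁ τ₂ τ₃} → Tm (τ₁ ∷ τ₂ ∷ τ₃ ∷ σ ∷ Γ) σ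
v3 = var (there (there (there here)))

-- Lemmas are stated as internal universal formulas: instantiating them by ∀E at
-- concrete terms makes the substitution compute, so no substitution lemmas are needed.
leq-resp-≐ : ∀ {Γ Δ} → Δ ⊢ ∀' ι (∀' ι (∀' ι (∀' ι
               (v3 ≐ v2 ⊃ v1 ≐ v0 ⊃ leq {Γ = _ ∷ _ ∷ _ ∷ _ ∷ Γ} v3 v1 ⊃ leq v2 v0))))
leq-resp-≐ = ∀I (∀I (∀I (∀I (⊃I (⊃I (⊃I
  (∃E (hyp (hd refl))
    (∃I v0 (≐-sym (≐-cong (Rc ι · v1 · v0 · stepT) (hyp (tl (tl (tl (hd refl))))))
            ⟫ hyp (hd refl) ⟫ hyp (tl (tl (hd refl))))))))))))

leq-refl : ∀ {Γ Δ} → Δ ⊢ ∀' ι (leq {Γ = ι ∷ Γ} v0 v0)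
leq-refl = ∀I (∃I zer (ax (ax-R0 v0 stepT)))

one : ∀ {Γ} → Tm Γ ι
one = suc · zer

constT : ∀ {Γ} ρ σ → Tm Γ ρ → Tm Γ (σ ⇒ ρ)
constT ρ σ x = Πc ρ σ · x

constOne : ∀ {Γ} δ → Tm Γ (δ ⇒ ι)
constOne δ = constT ι δ one

idT : ∀ {Γ} ρ → Tm Γ (ρ ⇒ ρ)
idT ρ = Σc ρ (ρ ⇒ ρ) ρ · Πc ρ (ρ ⇒ ρ) · Πc ρ ρ

idT-β : ∀ {Γ Δ} → Δ ⊢ ∀' ι (idT {ι ∷ Γ} ι · v0 ≐ v0)
idT-β = ∀I (ax (ax-Σ {ρ = ι ⇒ ι} {τ = ι} (Πc ι (ι ⇒ ι)) (Πc ι ι) v0)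
            ⟫ ax (ax-Π {σ = ι ⇒ ι} v0 (Πc ι ι · v0)))

-- λ x y. h x; in particular stepT = drop₂ suc
drop₂ : ∀ {Γ} → Tm Γ (ι ⇒ ι) → Tm Γ (ι ⇒ ι ⇒ ι)
drop₂ h = Σc ι ι (ι ⇒ ι) · (Πc (ι ⇒ ι ⇒ ι) ι · Πc ι ι) · h

drop₂-β : ∀ {Γ Δ} → Δ ⊢ ∀' (ι ⇒ ι) (∀' ι (∀' ι (drop₂ {_ ∷ _ ∷ _ ∷ Γ} v2 · v1 · v0 ≐ v2 · v1)))
drop₂-β = ∀I (∀I (∀I
  (∀E (ax (ax-Σ {δ = ι} {ρ = ι} {τ = ι ⇒ ι} (Πc (ι ⇒ ι ⇒ ι) ι · Πc ι ι) v2 v1)) v0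
   ⟫ ∀E (∀E (ax (ax-Π {σ = ι} (Πc ι ι) v1)) (v2 · v1)) v0
   ⟫ ax (ax-Π {σ = ι} (v2 · v1) v0))))

-- λ n. R n a s
recT : ∀ {Γ} → Tm Γ ι → Tm Γ (ι ⇒ ι ⇒ ι) → Tm Γ (ι ⇒ ι)
recT a s = Σc ι (ι ⇒ ι ⇒ ι) ι · (Σc ι ι ((ι ⇒ ι ⇒ ι) ⇒ ι) · Rc ι · constT ι ι a)
                             · constT (ι ⇒ ι ⇒ ι) ι s

recT-β : ∀ {Γ Δ} → Δ ⊢ ∀' ι (∀' (ι ⇒ ι ⇒ ι) (∀' ι
           (recT {_ ∷ _ ∷ _ ∷ Γ} v2 v1 · v0 ≐ Rc ι · v0 · v2 · v1)))
recT-β = ∀I (∀I (∀I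
  (ax (ax-Σ {τ = ι} (Σc ι ι ((ι ⇒ ι ⇒ ι) ⇒ ι) · Rc ι · constT ι ι v2) (constT (ι ⇒ ι ⇒ ι) ι v1) v0)
   ⟫ ∀E (ax (ax-Σ {τ = (ι ⇒ ι ⇒ ι) ⇒ ι} (Rc ι) (constT ι ι v2) v0)) (constT (ι ⇒ ι ⇒ ι) ι v1 · v0)
   ⟫ ≐-cong (Rc ι · v1 · v0 · (constT (ι ⇒ ι ⇒ ι) ι v2 · v1)) (ax (ax-Π {σ = ι} v2 v0))
   ⟫ ⊃E (ax (ext {τ = ι} (Rc ι · v0 · v2) (constT (ι ⇒ ι ⇒ ι) ι v1 · v0) v1))
        (ax (ax-Π {σ = ι} v1 v0)))))

compT : ∀ {Γ} δ → Tm Γ (ι ⇒ ι) → Tm Γ (δ ⇒ ι) → Tm Γ (δ ⇒ ι)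
compT δ f h = Σc δ ι ι · constT (ι ⇒ ι) δ f · h

compT-β : ∀ {Γ Δ} δ → Δ ⊢ ∀' (ι ⇒ ι) (∀' (δ ⇒ ι) (∀' δ
            (compT {_ ∷ _ ∷ _ ∷ Γ} δ v2 v1 · v0 ≐ v2 · (v1 · v0))))
compT-β δ = ∀I (∀I (∀I (ax (ax-Σ {τ = ι} (constT (ι ⇒ ι) δ v2) v1 v0)
  ⟫ ∀E (ax (ax-Π {σ = δ} v2 v0)) (v1 · v0))))

evalAt : ∀ {Γ} → Tm Γ ι → Tm Γ (ty1 ⇒ ι)
evalAt n = Σc ty1 ι ι · idT ty1 · constT ι ty1 n

evalAt-β : ∀ {Γ Δ} → Δ ⊢ ∀' ι (∀' ty1 (evalAt {_ ∷ _ ∷ Γ} v1 · v0 ≐ v0 · v1))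
evalAt-β = ∀I (∀I (ax (ax-Σ {τ = ι} (idT ty1) (constT ι ty1 v1) v0)
  ⟫ ∀E (ax (ax-Σ {τ = ty1} (Πc ty1 (ty1 ⇒ ty1)) (Πc ty1 ty1) v0)) (constT ι ty1 v1 · v0)
  ⟫ ∀E (ax (ax-Π {σ = ty1 ⇒ ty1} v0 (Πc ty1 ty1 · v0))) (constT ι ty1 v1 · v0)
  ⟫ ≐-cong (v1 · v0) (ax (ax-Π {σ = ty1} v1 v0))))

+-suc : ∀ {Γ Δ} → Δ ⊢ ∀' ι (∀' ι (plusT {_ ∷ _ ∷ Γ} v1 (suc · v0) ≐ suc · plusT v1 v0))
+-suc = ∀I (∀I (ax (ax-RS {ρ = ι} v0 v1 stepT) ⟫ ∀E (∀E (∀E drop₂-β suc) (plusT v1 v0)) v0))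

+-identityˡ : ∀ {Γ Δ} → Δ ⊢ ∀' ι (plusT {ι ∷ Γ} zer v0 ≐ v0)
+-identityˡ = ⊃E (ax (ind (plusT zer v0 ≐ v0) i≐))
  (∧I (ax (ax-R0 {ρ = ι} zer stepT))
      (∀I (⊃I (∀E (∀E +-suc zer) v0 ⟫ ≐-cong (suc · v0) (hyp (hd refl))))))

suc-+ : ∀ {Γ Δ} → Δ ⊢ ∀' ι (∀' ι (plusT {_ ∷ _ ∷ Γ} (suc · v1) v0 ≐ suc · plusT v1 v0))
suc-+ = ∀I (⊃E (ax (ind (plusT (suc · v1) v0 ≐ suc · plusT v1 v0) i≐))
  (∧I (ax (ax-R0 {ρ = ι} (suc · v0) stepT)
       ⟫ ≐-sym (≐-cong (suc · v0) (ax (ax-R0 {ρ = ι} v0 stepT))))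
      (∀I (⊃I (∀E (∀E +-suc (suc · v1)) v0
               ⟫ ≐-cong (suc · v0) (hyp (hd refl))
               ⟫ ≐-sym (≐-cong (suc · v0) (∀E (∀E +-suc v1) v0)))))))

-- λ x y. y, the step function of the predecessor R n 0 predStep
predStep : ∀ {Γ} → Tm Γ (ι ⇒ ι ⇒ ι)
predStep = constT (ι ⇒ ι) ι (idT ι)

pred-suc : ∀ {Γ Δ} → Δ ⊢ ∀' ι (Rc {ι ∷ Γ} ι · (suc · v0) · zer · predStep ≐ v0)
pred-suc = ∀I (ax (ax-RS {ρ = ι} v0 zer predStep)
  ⟫ ∀E (ax (ax-Π {ρ = ι ⇒ ι} {σ = ι} (idT ι) (Rc ι · v0 · zer · predStep))) v0
  ⟫ ∀E idT-β v0)

monusStep : ∀ {Γ} → Tm Γ (ι ⇒ ι ⇒ ι)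
monusStep = drop₂ (recT zer predStep)

monusStep-β : ∀ {Γ Δ} → Δ ⊢ ∀' ι (∀' ι (monusStep {_ ∷ _ ∷ Γ} · v1 · v0 ≐ Rc ι · v1 · zer · predStep))
monusStep-β = ∀I (∀I (∀E (∀E (∀E drop₂-β (recT zer predStep)) v1) v0
                     ⟫ ∀E (∀E (∀E recT-β zer) predStep) v1))

-- n ∸ k, as the k-fold predecessor of n
monusT : ∀ {Γ} → Tm Γ ι → Tm Γ ι → Tm Γ ι
monusT n k = Rc ι · k · n · monusStep

m+n∸m : ∀ {Γ Δ} → Δ ⊢ ∀' ι (∀' ι (monusT {_ ∷ _ ∷ Γ} (plusT v1 v0) v1 ≐ v0))
m+n∸m = ⊃E (ax (ind (∀' ι (monusT (plusT v1 v0) v1 ≐ v0)) (i∀ i≐)))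
  (∧I (∀I (ax (ax-R0 {ρ = ι} (plusT zer v0) monusStep) ⟫ ∀E +-identityˡ v0))
      (∀I (⊃I (∀I
        (ax (ax-RS {ρ = ι} v1 (plusT (suc · v1) v0) monusStep)
         ⟫ ∀E (∀E monusStep-β (monusT (plusT (suc · v1) v0) v1)) v1
         ⟫ ≐-cong (Rc ι · v0 · zer · predStep)
             (≐-cong (monusT v0 v2) (∀E (∀E suc-+ v1) v0 ⟫ ≐-sym (∀E (∀E +-suc v1) v0))
              ⟫ ∀E (hyp (hd refl)) (suc · v0))
         ⟫ ∀E pred-suc v0)))))

n∸n : ∀ {Γ Δ} → Δ ⊢ ∀' ι (monusT {ι ∷ Γ} v0 v0 ≐ zer)
n∸n = ∀I (≐-cong (monusT v0 v1) (≐-sym (ax (ax-R0 {ρ = ι} v0 stepT))) ⟫ ∀E (∀E m+n∸m v0) zer)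

sgStep : ∀ {Γ} → Tm Γ (ι ⇒ ι ⇒ ι)
sgStep = constT (ι ⇒ ι) ι (constOne ι)

sgT : ∀ {Γ} → Tm Γ ι → Tm Γ ι
sgT x = Rc ι · x · zer · sgStep

sg-zero : ∀ {Γ Δ} → Δ ⊢ sgT {Γ} zer ≐ zer
sg-zero = ax (ax-R0 {ρ = ι} zer sgStep)

sg-suc : ∀ {Γ Δ} → Δ ⊢ ∀' ι (sgT {ι ∷ Γ} (suc · v0) ≐ one)
sg-suc = ∀I (ax (ax-RS {ρ = ι} v0 zer sgStep)
  ⟫ ∀E (ax (ax-Π {ρ = ι ⇒ ι} {σ = ι} (constOne ι) (sgT v0))) v0
  ⟫ ax (ax-Π {ρ = ι} {σ = ι} one v0))

sg≤1 : ∀ {Γ Δ} → Δ ⊢ ∀' ι (leq (sgT {ι ∷ Γ} v0) one)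
sg≤1 = ⊃E (ax (ind (leq (sgT v0) one) (i∃ i≐)))
  (∧I (∃I one (∀E (∀E +-suc (sgT zer)) zer
               ⟫ ≐-cong (suc · v0) (ax (ax-R0 {ρ = ι} (sgT zer) stepT) ⟫ sg-zero)))
      (∀I (⊃I (∃I zer (ax (ax-R0 {ρ = ι} (sgT (suc · v0)) stepT) ⟫ ∀E sg-suc v0)))))

sg∘ : ∀ {Γ} δ → Tm Γ (δ ⇒ ι) → Tm Γ (δ ⇒ ι)
sg∘ δ h = compT δ (recT zer sgStep) h

sg∘-β : ∀ {Γ Δ} δ → Δ ⊢ ∀' (δ ⇒ ι) (∀' δ (sg∘ {_ ∷ _ ∷ Γ} δ v1 · v0 ≐ sgT (v1 · v0)))
sg∘-β δ = ∀I (∀I (∀E (∀E (∀E (compT-β δ) (recT zer sgStep)) v1) v0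
                  ⟫ ∀E (∀E (∀E recT-β zer) sgStep) (v1 · v0)))

sg∘-≤*-constOne : ∀ {Γ} δ {Δ : List (Fm ((δ ⇒ ι) ∷ Γ))} →
                  Δ ⊢ maj (δ ⇒ ι) (sg∘ δ v0) (constOne δ)
sg∘-≤*-constOne δ = ∀I (∀I (⊃I (∧I
  (⊃E (⊃E (⊃E (∀E (∀E (∀E (∀E leq-resp-≐ (sgT (v2 · v1))) (sg∘ δ v2 · v1)) one) (constOne δ · v0))
                (≐-sym (∀E (∀E (sg∘-β δ) v2) v1)))
            (≐-sym (ax (ax-Π {ρ = ι} {σ = δ} one v0))))
      (∀E sg≤1 (v2 · v1)))
  (⊃E (⊃E (⊃E (∀E (∀E (∀E (∀E leq-resp-≐ one) (constOne δ · v1)) one) (constOne δ · v0))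
                (≐-sym (ax (ax-Π {ρ = ι} {σ = δ} one v1))))
            (≐-sym (ax (ax-Π {ρ = ι} {σ = δ} one v0))))
      (∀E leq-refl one)))))

st-sg∘ : ∀ {Γ Δ} δ → Δ ⊢ ∀' (δ ⇒ ι) (st (sg∘ {(δ ⇒ ι) ∷ Γ} δ v0))
st-sg∘ δ = ∀I (⊃E (⊃E (ax (st-maj (sg∘ δ v0) (constOne δ))) (ax (st-closed (constOne δ))))
                  (sg∘-≤*-constOne δ))

lt : ∀ {Γ} → Tm Γ ι → Tm Γ ι → Fm Γ
lt s t = leq (suc · s) t

-- n ↦ sg (N ∸ n)
cutoff : ∀ {Γ} → Tm Γ ι → Tm Γ ty1
cutoff N = sg∘ ι (recT N monusStep)

-- h ↦ sg (h N)
sgEvalAt : ∀ {Γ} → Tm Γ ι → Tm Γ ty2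
sgEvalAt N = sg∘ ty1 (evalAt N)

cutoff-below : ∀ {Γ Δ} → Δ ⊢ ∀' ι (∀' ι (lt v0 v1 ⊃ cutoff {_ ∷ _ ∷ Γ} v1 · v0 ≐ one))
cutoff-below = ∀I (∀I (⊃I (∃E (hyp (hd refl))
  (∀E (∀E (sg∘-β ι) (recT v2 monusStep)) v1
   ⟫ ≐-cong (sgT v0)
       (∀E (∀E (∀E recT-β v2) monusStep) v1
        ⟫ ≐-cong (monusT v0 v2)
            (≐-sym (hyp (hd refl)) ⟫ ∀E (∀E suc-+ v1) v0 ⟫ ≐-sym (∀E (∀E +-suc v1) v0))
        ⟫ ∀E (∀E m+n∸m v1) (suc · v0))
   ⟫ ∀E sg-suc v0))))

cutoff-self : ∀ {Γ Δ} → Δ ⊢ ∀' ι (cutoff {ι ∷ Γ} v0 · v0 ≐ zer)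
cutoff-self = ∀I (∀E (∀E (sg∘-β ι) (recT v0 monusStep)) v0
  ⟫ ≐-cong (sgT v0) (∀E (∀E (∀E recT-β v0) monusStep) v0 ⟫ ∀E n∸n v0)
  ⟫ sg-zero)

∃-upper-bound-of-standard : ∀ {Γ Δ} → Δ ⊢ ∃' ι (∀st ι (lt {_ ∷ _ ∷ Γ} v0 v1))
∃-upper-bound-of-standard =
  ⊃E (ax (Iω {σ = ι} {τ = ι} (lt v0 v1) (i∃ i≐)))
     (∀I (⊃I (∃I (suc · v0) (∀I (⊃I (∃E (hyp (hd refl))
       (∃I v0 (∀E (∀E suc-+ v1) v0 ⟫ ≐-cong (suc · v0) (hyp (hd refl))))))))))

upper-bound-of-standard⇒⊥ : ∀ {Γ} → ∀st ι (lt {_ ∷ _ ∷ Γ} v0 v1) ∷ [] ⊢ ⊥'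
upper-bound-of-standard⇒⊥ {Γ} = ⊃E (ax (suc-ne zer)) (≐-sym Y1≐1 ⟫ Y1≐Yg ⟫ Yg≐0)
  where
  H : List (Fm (ι ∷ Γ))
  H = ∀st ι (lt v0 v1) ∷ []

  st-Y : H ⊢ st (sgEvalAt v0)
  st-Y = ∀E (st-sg∘ ty1) (evalAt v0)

  st-g : H ⊢ st (cutoff v0)
  st-g = ∀E (st-sg∘ ι) (recT v0 monusStep)

  st-1 : H ⊢ st (constOne ι)
  st-1 = ax (st-closed (constOne ι))

  1≐g-on-standard : H ⊢ ∀st ι (constOne ι · v0 ≐ cutoff v1 · v0)
  1≐g-on-standard = ∀I (⊃I (ax (ax-Π {ρ = ι} {σ = ι} one v0)
    ⟫ ≐-sym (⊃E (∀E (∀E cutoff-below v1) v0) (⊃E (∀E (hyp (tl (hd refl))) v0) (hyp (hd refl))))))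

  Y1≐Yg : H ⊢ sgEvalAt v0 · constOne ι ≐ sgEvalAt v0 · cutoff v0
  Y1≐Yg = ⊃E (⊃E (∀E (⊃E (∀E (⊃E (∀E (axm e2) (sgEvalAt v0)) st-Y) (constOne ι)) st-1)
                    (cutoff v0)) st-g)
             1≐g-on-standard

  Y1≐1 : H ⊢ sgEvalAt v0 · constOne ι ≐ one
  Y1≐1 = ∀E (∀E (sg∘-β ty1) (evalAt v0)) (constOne ι)
    ⟫ ≐-cong (sgT v0) (∀E (∀E evalAt-β v0) (constOne ι) ⟫ ax (ax-Π {ρ = ι} {σ = ι} one v0))
    ⟫ ∀E sg-suc zer

  Yg≐0 : H ⊢ sgEvalAt v0 · cutoff v0 ≐ zer
  Yg≐0 = ∀E (∀E (sg∘-β ty1) (evalAt v0)) (cutoff v0)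
    ⟫ ≐-cong (sgT v0) (∀E (∀E evalAt-β v0) (cutoff v0) ⟫ ∀E cutoff-self v0)
    ⟫ sg-zero

corollary3p11 : Inconsistent DG+E2st
corollary3p11 = ∃E ∃-upper-bound-of-standard upper-bound-of-standard⇒⊥
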